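{- For every $n\ge1$, the map $s\mapsto \textsc{UnrankTree}(n,s)$ defined below is a bijection from $\{0,1,\dots,g_n-1\}$ onto the set of weakly increasing Schröder trees with $n$ leaves. In particular, if $s$ is chosen uniformly at random in $\{0,\dots,g_n-1\}$, then $\textsc{UnrankTree}(n,s)$ is uniformly distributed over the weakly increasing Schröder trees with $n$ leaves.
   Context: A Schröder tree is a rooted plane tree (children of each node are ordered) in which every internal node has at least two children; its size is its number of leaves. A weakly increasing Schröder tree is a Schröder tree whose internal nodes carry labels from $\{1,\dots,L\}$ for some $L\ge0$, every value in $\{1,\dots,L\}$ being used by at least one internal node (several nodes may share a label), with labels strictly increasing along every root-to-leaf path; leaves are unlabeled. Let $g_1=1$ and $g_m=\sum_{k=1}^{m-1}\binom{m-1}{k-1}g_k$ for $m\ge2$ ($g_m$ is the number of weakly increasing Schröder trees with $m$ leaves). A composition of $m$ into $k$ parts is a sequence of $k$ positive integers summing to $m$. Fix a rule that lists the leaves of any plane tree in some order (e.g. left to right). UnrankComposition$(m,k,s)$, for $1\le k\le m$ and $0\le s<\binom{m-1}{k-1}$: if $m=k$, return $(1,\dots,1)$ ($k$ ones); else if $s<\binom{m-2}{k-1}$, let $C=$ UnrankComposition$(m-1,k,s)$ and return $C$ with its last part increased by $1$; else return UnrankComposition$(m-1,k-1,s-\binom{m-2}{k-1})$ with a final part $1$ appended. UnrankTree$(n,s)$, for $0\le s<g_n$: if $n=1$ return the single leaf. Otherwise scan $k=n-1,n-2,\dots$ and take the first (largest) $k\in\{1,\dots,n-1\}$ with $s<\sum_{j=k}^{n-1}\binom{n-1}{j-1}g_j$;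 set $r=s-\sum_{j=k+1}^{n-1}\binom{n-1}{j-1}g_j$. Let $T=$ UnrankTree$(k, r \bmod g_k)$ and $C=(C_1,\dots,C_k)=$ UnrankComposition$(n,k,\lfloor r/g_k\rfloor)$. Let $L$ be the largest label of $T$ ($L=0$ if $T$ is a leaf). For $i=1,\dots,k$, if $C_i\ge2$ replace the $i$-th leaf of $T$ by an internal node labeled $L+1$ with $C_i$ leaf children (leaves with $C_i=1$ are left unchanged). Return the resulting tree. -}

module Defs where

open import Data.Nat using (ℕ; zero; suc; _+_; _*_; _∸_; _≤_; _<_; _⊔_; _≡ᵇ_; _<ᵇ_; _<?_; _/_; _%_)
open import Data.Nat.Combinatorics using (_C_)
open import Data.Bool using (if_then_else_)
open import Data.Fin as Fin using (Fin; toℕ; fromℕ<)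
open import Data.Fin.Permutation using (Permutation′; _⟨$⟩ˡ_)
open import Data.Vec as Vec using (Vec; []; _∷_; _∷ʳ_; lookup)
open import Data.List using (List; []; _∷_; length; replicate; _++_)
open import Data.List.Relation.Unary.All using (All)
open import Data.List.Relation.Unary.Any using (Any)
open import Data.Product using (Σ; _×_; _,_; proj₁; proj₂)
open import Relation.Binary.PropositionalEquality using (_≡_)
open import Relation.Nullary using (yes; no)

data Tree : Set where
  leaf : Tree
  node : ℕ → List Tree → Tree

mutual
  leafCount : Tree → ℕ
  leafCount leaf        = 1
  leafCount (node _ ts) = leafCounts ts

  leafCounts : List Tree → ℕ
  leafCounts []       = 0
  leafCounts (t ∷ ts) = leafCount t + leafCounts ts

mutual
  maxLabel : Tree → ℕ
  maxLabel leaf        = 0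
  maxLabel (node ℓ ts) = ℓ ⊔ maxLabels ts

  maxLabels : List Tree → ℕ
  maxLabels []       = 0
  maxLabels (t ∷ ts) = maxLabel t ⊔ maxLabels ts

data Schroder : Tree → Set where
  leaf : Schroder leaf
  node : ∀ {ℓ ts} → 2 ≤ length ts → All Schroder ts → Schroder (node ℓ ts)

-- LabelsIn lo hi t : every internal node label ℓ satisfies lo < ℓ ≤ hi,
-- and labels strictly increase from parent to (internal) child.
data LabelsIn (lo hi : ℕ) : Tree → Set where
  leaf : LabelsIn lo hi leaf
  node : ∀ {ℓ ts} → lo < ℓ → ℓ ≤ hi → All (LabelsIn ℓ hi) ts →
         LabelsIn lo hi (node ℓ ts)

data Occurs (v : ℕ) : Tree → Set where
  here  : ∀ {ts} → Occurs v (node v ts)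
  there : ∀ {ℓ ts} → Any (Occurs v) ts → Occurs v (node ℓ ts)

-- t is a weakly increasing Schröder tree with n leaves:
-- labels from {1..L}, all of {1..L} used, strictly increasing along
-- root-to-leaf paths.
WISTree : ℕ → Tree → Set
WISTree n t =
  Schroder t × leafCount t ≡ n ×
  Σ ℕ (λ L → LabelsIn 0 L t × (∀ v → 1 ≤ v → v ≤ L → Occurs v t))

-- The numbers g_m.   gs n = (g_1 , … , g_n).

sumFin : ∀ {n} → (Fin n → ℕ) → ℕ
sumFin {zero}  f = 0
sumFin {suc n} f = f Fin.zero + sumFin (λ i → f (Fin.suc i))

gs : (n : ℕ) → Vec ℕ n
gs zero          = []
gs (suc zero)    = 1 ∷ []
gs (suc (suc m)) =
  let v = gs (suc m) in
  -- g_{m+2} = Σ_{k=1}^{m+1} C(m+1, k-1) g_k ; index i = k-1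
  v ∷ʳ sumFin (λ (i : Fin (suc m)) → (suc m C toℕ i) * lookup v i)

-- g n = g_n for n ≥ 1 (g 0 = 0 is an unused convention)
g : ℕ → ℕ
g zero    = 0
g (suc n) = Vec.last (gs (suc n))

incLast : List ℕ → List ℕ
incLast []           = []
incLast (x ∷ [])     = suc x ∷ []
incLast (x ∷ y ∷ xs) = x ∷ incLast (y ∷ xs)

-- unrankComposition m k s, meaningful for 1 ≤ k ≤ m, s < C(m-1,k-1)
unrankComposition : ℕ → ℕ → ℕ → List ℕ
unrankComposition zero    k s = replicate k 1
unrankComposition (suc m) k s =
  if suc m ≡ᵇ k then replicate k 1
  else if s <ᵇ ((m ∸ 1) C (k ∸ 1))
       then incLast (unrankComposition m k s)
       else unrankComposition m (k ∸ 1) (s ∸ ((m ∸ 1) C (k ∸ 1))) ++ (1 ∷ [])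

-- A rule listing the leaves of any plane tree t: for each
-- t, a permutation π of Fin (leafCount t) where π ⟨$⟩ʳ i is the
-- left-to-right position of the i-th leaf (0-based) in the rule's listing.

LeafOrder : Set
LeafOrder = (t : Tree) → Permutation′ (leafCount t)

mutual
  graftAt : (ℕ → ℕ) → ℕ → Tree → ℕ → Tree × ℕ
  graftAt a lab leaf p =
    (if 1 <ᵇ a p then node lab (replicate (a p) leaf) else leaf) , suc p
  graftAt a lab (node ℓ ts) p =
    let r = graftsAt a lab ts p in node ℓ (proj₁ r) , proj₂ r

  graftsAt : (ℕ → ℕ) → ℕ → List Tree → ℕ → List Tree × ℕ
  graftsAt a lab []       p = [] , p
  graftsAt a lab (t ∷ ts) p =
    let r₁ = graftAt a lab t p
        r₂ = graftsAt a lab ts (proj₂ r₁)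
    in (proj₁ r₁ ∷ proj₁ r₂) , proj₂ r₂

-- i-th entry of a list (0-based), default 1
nth : List ℕ → ℕ → ℕ
nth []       _       = 1
nth (x ∷ xs) zero    = x
nth (x ∷ xs) (suc i) = nth xs i

-- the grafting step of UnrankTree: the i-th leaf of T in the rule's order
-- receives part C_i of the composition C
graft : LeafOrder → Tree → List ℕ → Tree
graft rule T cs = proj₁ (graftAt arity (suc (maxLabel T)) T 0)
  where
    arity : ℕ → ℕ
    arity p with p <? leafCount T
    ... | yes p<n = nth cs (toℕ (rule T ⟨$⟩ˡ fromℕ< p<n))
    ... | no  _   = 1

-- scan n k acc s : scan k, k-1, …, 1 with acc = Σ_{j=k+1}^{n-1} C(n-1,j-1) g_j;
-- return the first k with s < acc + C(n-1,k-1) g_k, together with r = s - acc.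
scan : ℕ → ℕ → ℕ → ℕ → ℕ × ℕ
scan n zero     acc s = 1 , 0   -- unreachable for s < g n
scan n (suc k′) acc s =
  let new = acc + ((n ∸ 1) C k′) * g (suc k′) in
  if s <ᵇ new then (suc k′ , s ∸ acc) else scan n k′ new s

divN modN : ℕ → ℕ → ℕ
divN r zero    = 0
divN r (suc d) = r / suc d
modN r zero    = 0
modN r (suc d) = r % suc d

-- fuel-bounded recursion (fuel ≥ n suffices since recursive calls
-- strictly decrease n)
unrankTreeF : LeafOrder → ℕ → ℕ → ℕ → Tree
unrankTreeF rule zero       n s = leaf
unrankTreeF rule (suc fuel) n s =
  if n ≡ᵇ 1 then leaf
  else
    (let kr = scan n (n ∸ 1) 0 s
         k  = proj₁ kr
         r  = proj₂ kr
         T  = unrankTreeF rule fuel k (modN r (g k))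
         cs = unrankComposition n k (divN r (g k))
     in graft rule T cs)

unrankTree : LeafOrder → ℕ → ℕ → Tree
unrankTree rule n s = unrankTreeF rule n n s

module Submission where

-- Every
-- stage of the algorithm is then a bijection of its own:
--   * UnrankComposition(m, k, ·) enumerates the compositions of m into k
--     parts; its two branches enumerate those obtained from compositions of
--     m-1 by raising the last part, resp. by appending a last part 1;
--   * the scan of UnrankTree enumerates blocks k = n-1, …, 1 of sizes
--     C(n-1, k-1) g_k, which add up to g_n;
--   * in block k, r ↦ (r mod g_k, r div g_k) ↦ (a tree, a composition);
--   * grafting a composition of n into k parts onto the leaves of a tree with
--     k < n leaves, in the rule's order, is a bijection onto the trees with n
--     leaves: pruning the largest label inverts it, and the rule merely
--     permutes the parts.

open import Defs
open import Data.Nat using (ℕ; zero; suc; _+_; _*_; _∸_; _/_; _%_; _≤_; _<_; z≤n; s≤s; _<ᵇ_)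
open import Data.Nat.Properties
open import Data.Nat.DivMod using (m%n<n; m<n*o⇒m/o<n; m≡m%n+[m/n]*n; [m+kn]%n≡m%n; m<n⇒m%n≡m)
open import Data.Nat.Combinatorics using (_C_; nCn≡1; nCk+nC[k+1]≡[n+1]C[k+1])
open import Data.Nat.Induction using (<-rec)
open import Data.Nat.ListAction using (sum)
open import Data.Nat.ListAction.Properties using (sum-++)
open import Data.Bool as Bool using (true; false; if_then_else_)
open import Data.List using (List; []; _∷_; length; replicate; _++_; _∷ʳ_; initLast; _∷ʳ′_; tabulate)
open import Data.List.Properties
  using (length-++; length-replicate; length-tabulate; tabulate-cong; ∷-injective; ∷ʳ-injective; ∷ʳ-injectiveˡ; ∷ʳ-injectiveʳ)
open import Data.List.Relation.Unary.All using (All; []; _∷_)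
import Data.List.Relation.Unary.All.Properties as All
open import Data.List.Relation.Unary.Any using (Any; here; there)
import Data.List.Relation.Unary.Any.Properties as Any
open import Data.Vec as Vec using (Vec)
import Data.Vec.Properties as Vec
open import Data.Fin as Fin using (Fin; toℕ; fromℕ<)
open import Data.Fin.Properties using (toℕ<n; fromℕ<-toℕ)
open import Data.Fin.Permutation using (Permutation′; flip; _⟨$⟩ˡ_; _⟨$⟩ʳ_; inverseˡ)
import Algebra.Properties.CommutativeMonoid.Sum as Summation
open import Data.Product as Prod using (Σ; _×_; _,_; proj₁; proj₂)
open import Data.Sum using (_⊎_; inj₁; inj₂; [_,_]′)
open import Data.Empty using (⊥; ⊥-elim)
open import Function using (_∘_)
open import Relation.Nullary using (¬_; yes; no; contradiction)
open import Relation.Binary.PropositionalEquality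
  using (_≡_; _≢_; refl; sym; trans; cong; cong₂; subst; module ≡-Reasoning)

open Summation +-0-commutativeMonoid using () renaming (sum to ∑; sum-permute to ∑-permute)

private variable
  A B X : Set

if-true : ∀ {b} {x y : A} → Bool.T b → (if b then x else y) ≡ x
if-true {b = true} _ = refl

if-false : ∀ {b} {x y : A} → ¬ Bool.T b → (if b then x else y) ≡ y
if-false {b = true}  ¬t = ⊥-elim (¬t _)
if-false {b = false} _  = refl

Below : ℕ → ℕ → Set
Below N s = s < N

record BijectionOn {A B : Set} (P : A → Set) (Q : B → Set) (f : A → B) : Set where
  field
    maps      : ∀ {a} → P a → Q (f a)
    injective : ∀ {a a′} → P a → P a′ → f a ≡ f a′ → a ≡ a′
    onto      : ∀ {b} → Q b → Σ A (λ a → P a × f a ≡ b)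

open BijectionOn

module _ {P : A → Set} {Q : B → Set} {f : A → B} where

  ∘-bij : {R : X → Set} {h : B → X} →
          BijectionOn P Q f → BijectionOn Q R h → BijectionOn P R (h ∘ f)
  ∘-bij {h = h} F H = record
    { maps      = maps H ∘ maps F
    ; injective = λ p p′ e → injective F p p′ (injective H (maps F p) (maps F p′) e)
    ; onto      = λ r →
        let (b , qb , hb) = onto H r
            (a , pa , fa) = onto F qb
        in  a , pa , trans (cong h fa) hb
    }

  bij-cong : {h : A → B} → (∀ {a} → P a → f a ≡ h a) →
             BijectionOn P Q f → BijectionOn P Q h
  bij-cong {h} f≗h F = record
    { maps      = λ p → subst Q (f≗h p) (maps F p)
    ; injective = λ p p′ e → injective F p p′ (trans (f≗h p) (trans e (sym (f≗h p′))))
    ; onto      = λ q → let (a , pa , fa) = onto F q in a , pa , trans (sym (f≗h pa)) fa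
    }

  bij-retarget : {Q′ : B → Set} → (∀ {b} → Q b → Q′ b) → (∀ {b} → Q′ b → Q b) →
                 BijectionOn P Q f → BijectionOn P Q′ f
  bij-retarget to from F = record
    { maps      = to ∘ maps F
    ; injective = injective F
    ; onto      = onto F ∘ from
    }

image-bij : {P : A → Set} {f : A → B} → (∀ {a a′} → P a → P a′ → f a ≡ f a′ → a ≡ a′) →
            BijectionOn P (λ b → Σ A (λ a → P a × f a ≡ b)) f
image-bij inj = record { maps = λ p → _ , p , refl ; injective = inj ; onto = λ q → q }

single-bij : {Q : A → Set} {c : A} → Q c → (∀ {b} → Q b → c ≡ b) →
             BijectionOn (Below 1) Q (λ _ → c)
single-bij qc uniq = record
  { maps      = λ _ → qc
  ; injective = λ { (s≤s z≤n) (s≤s z≤n) _ → refl }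
  ; onto      = λ q → 0 , s≤s z≤n , uniq q
  }

×-bij : {P₁ : A → Set} {Q₁ : B → Set} {f₁ : A → B} {A′ B′ : Set}
        {P₂ : A′ → Set} {Q₂ : B′ → Set} {f₂ : A′ → B′} →
        BijectionOn P₁ Q₁ f₁ → BijectionOn P₂ Q₂ f₂ →
        BijectionOn (λ a → P₁ (proj₁ a) × P₂ (proj₂ a)) (λ b → Q₁ (proj₁ b) × Q₂ (proj₂ b))
                    (Prod.map f₁ f₂)
×-bij F₁ F₂ = record
  { maps      = Prod.map (maps F₁) (maps F₂)
  ; injective = λ (p₁ , p₂) (p₁′ , p₂′) e →
      cong₂ _,_ (injective F₁ p₁ p₁′ (cong proj₁ e)) (injective F₂ p₂ p₂′ (cong proj₂ e))
  ; onto      = λ (q₁ , q₂) →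
      let (a₁ , p₁ , e₁) = onto F₁ q₁
          (a₂ , p₂ , e₂) = onto F₂ q₂
      in  (a₁ , a₂) , (p₁ , p₂) , cong₂ _,_ e₁ e₂
  }

Σ-bij : {V : ℕ → Set} {P : ℕ → A → Set} {Q : ℕ → B → Set} {f : ℕ → A → B} →
        (∀ {k} → V k → BijectionOn (P k) (Q k) (f k)) →
        BijectionOn (λ a → V (proj₁ a) × P (proj₁ a) (proj₂ a))
                    (λ b → V (proj₁ b) × Q (proj₁ b) (proj₂ b))
                    (λ a → proj₁ a , f (proj₁ a) (proj₂ a))
Σ-bij {A = A} {V = V} {P} {Q} {f} F = record
  { maps      = λ (v , p) → v , maps (F v) p
  ; injective = inj
  ; onto      = λ (v , q) → let (a , p , e) = onto (F v) q in (_ , a) , (v , p) , cong (_ ,_) e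
  }
  where
  inj : ∀ {a a′ : ℕ × A} → V (proj₁ a) × P (proj₁ a) (proj₂ a) → V (proj₁ a′) × P (proj₁ a′) (proj₂ a′) →
        (proj₁ a , f (proj₁ a) (proj₂ a)) ≡ (proj₁ a′ , f (proj₁ a′) (proj₂ a′)) → a ≡ a′
  inj {k , a} {k′ , a′} (v , p) (_ , p′) e with cong proj₁ e
  ... | refl = cong (k ,_) (injective (F v) p p′ (cong proj₂ e))

-- Division with remainder by N, written for all N (for N = 0 all sets are empty).
divMod-bij : ∀ M N → BijectionOn (Below (M * N)) (λ p → proj₁ p < N × proj₂ p < M)
                                 (λ r → modN r N , divN r N)
divMod-bij M zero = record
  { maps      = λ {r} r<0 → ⊥-elim (n≮0 (subst (r <_) (*-zeroʳ M) r<0))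
  ; injective = λ {r} r<0 _ _ → ⊥-elim (n≮0 (subst (r <_) (*-zeroʳ M) r<0))
  ; onto      = λ ()
  }
divMod-bij M N@(suc _) = record
  { maps      = λ {r} r<MN → m%n<n r N , m<n*o⇒m/o<n r<MN
  ; injective = λ {r} {r′} _ _ e → begin
      r                           ≡⟨ m≡m%n+[m/n]*n r N ⟩
      r % N + (r / N) * N         ≡⟨ cong₂ (λ x y → x + y * N) (cong proj₁ e) (cong proj₂ e) ⟩
      r′ % N + (r′ / N) * N       ≡⟨ sym (m≡m%n+[m/n]*n r′ N) ⟩
      r′                          ∎
  ; onto      = λ {(x , y)} (x<N , y<M) →
      x + y * N ,
      <-≤-trans (+-monoˡ-< (y * N) x<N) (*-monoˡ-≤ N y<M) ,
      cong₂ _,_ (mod-inv x y x<N) (div-inv x y x<N)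
  }
  where
  open ≡-Reasoning
  mod-inv : ∀ x y → x < N → (x + y * N) % N ≡ x
  mod-inv x y x<N = trans ([m+kn]%n≡m%n x y N) (m<n⇒m%n≡m x<N)
  div-inv : ∀ x y → x < N → (x + y * N) / N ≡ y
  div-inv x y x<N = *-cancelʳ-≡ _ y N (+-cancelˡ-≡ x _ _ (begin
    x + ((x + y * N) / N) * N               ≡⟨ cong (_+ ((x + y * N) / N) * N) (sym (mod-inv x y x<N)) ⟩
    (x + y * N) % N + ((x + y * N) / N) * N ≡⟨ sym (m≡m%n+[m/n]*n (x + y * N) N) ⟩
    x + y * N                               ∎))

splitAt : ℕ → (ℕ → X) → (ℕ → X) → ℕ → X
splitAt A f h s = if s <ᵇ A then f s else h (s ∸ A)

splitAt-below : ∀ {A s} (f h : ℕ → X) → s < A → splitAt A f h s ≡ f s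
splitAt-below f h s<A = if-true (<⇒<ᵇ s<A)

splitAt-above : ∀ {A s} (f h : ℕ → X) → A ≤ s → splitAt A f h s ≡ h (s ∸ A)
splitAt-above {A = A} {s} f h A≤s = if-false (λ t → <⇒≱ (<ᵇ⇒< s A t) A≤s)

split-bij : ∀ {A B} {Q₁ Q₂ : X → Set} {f h : ℕ → X} →
            BijectionOn (Below A) Q₁ f → BijectionOn (Below B) Q₂ h →
            (∀ {c} → Q₁ c → Q₂ c → ⊥) →
            BijectionOn (Below (A + B)) (λ c → Q₁ c ⊎ Q₂ c) (splitAt A f h)
split-bij {A = A} {B} {Q₁} {Q₂} {f} {h} F H disjoint = record
  { maps      = λ {s} s<A+B → case s s<A+B
  ; injective = inj
  ; onto      = λ
      { (inj₁ q) → let (a , a<A , e) = onto F q in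
          a , ≤-trans a<A (m≤m+n A B) , trans (below a<A) e
      ; (inj₂ q) → let (b , b<B , e) = onto H q in
          A + b , +-monoʳ-< A b<B ,
          trans (beyond (m≤m+n A b)) (trans (cong h (m+n∸m≡n A b)) e)
      }
  }
  where
  below : ∀ {s} → s < A → splitAt A f h s ≡ f s
  below = splitAt-below f h

  beyond : ∀ {s} → A ≤ s → splitAt A f h s ≡ h (s ∸ A)
  beyond = splitAt-above f h

  above : ∀ {s} → s < A + B → A ≤ s → s ∸ A < B
  above {s} s<A+B A≤s = +-cancelˡ-< A _ _ (subst (_< A + B) (sym (m+[n∸m]≡n A≤s)) s<A+B)

  case : ∀ s → s < A + B → Q₁ (splitAt A f h s) ⊎ Q₂ (splitAt A f h s)
  case s s<A+B with s <? A
  ... | yes s<A = inj₁ (subst Q₁ (sym (below s<A)) (maps F s<A))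
  ... | no  s≮A = inj₂ (subst Q₂ (sym (beyond (≮⇒≥ s≮A))) (maps H (above s<A+B (≮⇒≥ s≮A))))

  inj : ∀ {s s′} → s < A + B → s′ < A + B → splitAt A f h s ≡ splitAt A f h s′ → s ≡ s′
  inj {s} {s′} lt lt′ e with s <? A | s′ <? A
  ... | yes p | yes p′ = injective F p p′
      (trans (sym (below p)) (trans e (below p′)))
  ... | no ¬p | no ¬p′ = ∸-cancelʳ-≡ (≮⇒≥ ¬p) (≮⇒≥ ¬p′)
      (injective H (above lt (≮⇒≥ ¬p)) (above lt′ (≮⇒≥ ¬p′))
        (trans (sym (beyond (≮⇒≥ ¬p))) (trans e (beyond (≮⇒≥ ¬p′)))))
  ... | yes p | no ¬p′ = ⊥-elim (disjoint (maps F p)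
      (subst Q₂ (trans (sym (beyond (≮⇒≥ ¬p′))) (trans (sym e) (below p)))
             (maps H (above lt′ (≮⇒≥ ¬p′)))))
  ... | no ¬p | yes p′ = ⊥-elim (disjoint (maps F p′)
      (subst Q₂ (trans (sym (beyond (≮⇒≥ ¬p))) (trans e (below p′)))
             (maps H (above lt (≮⇒≥ ¬p)))))

bij-resize : ∀ {N N′} {Q : A → Set} {f : ℕ → A} → N ≡ N′ →
             BijectionOn (Below N) Q f → BijectionOn (Below N′) Q f
bij-resize refl F = F

IsComp : ℕ → ℕ → List ℕ → Set
IsComp n k cs = length cs ≡ k × All (1 ≤_) cs × sum cs ≡ n

length≤sum : ∀ {xs} → All (1 ≤_) xs → length xs ≤ sum xs
length≤sum []       = z≤n
length≤sum (p ∷ ps) = +-mono-≤ p (length≤sum ps)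

parts<sum : ∀ {n k xs} → IsComp n k xs → Any (2 ≤_) xs → k < n
parts<sum (refl , ps , refl) = go ps
  where
  go : ∀ {xs} → All (1 ≤_) xs → Any (2 ≤_) xs → length xs < sum xs
  go (_ ∷ ps) (here 2≤) = +-mono-≤ 2≤ (length≤sum ps)
  go (p ∷ ps) (there b) = +-mono-≤-< p (go ps b)

some-part≥2 : ∀ {n k xs} → IsComp n k xs → k < n → Any (2 ≤_) xs
some-part≥2 (refl , ps , refl) = go ps
  where
  go : ∀ {xs} → All (1 ≤_) xs → length xs < sum xs → Any (2 ≤_) xs
  go {x ∷ xs} (p ∷ ps) lt with 2 ≤? x
  ... | yes 2≤x = here 2≤x
  ... | no  2≰x = there (go ps (+-cancelˡ-< 1 _ _ (subst (λ y → 1 + length xs < y + sum xs) x≡1 lt)))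
    where
    x≡1 : x ≡ 1
    x≡1 = ≤-antisym (≤-pred (≰⇒> 2≰x)) p

ones-comp : ∀ k → IsComp k k (replicate k 1)
ones-comp zero    = refl , [] , refl
ones-comp (suc k) = let (l , ps , s) = ones-comp k in cong suc l , s≤s z≤n ∷ ps , cong suc s

ones-unique : ∀ {k xs} → IsComp k k xs → replicate k 1 ≡ xs
ones-unique {zero}  {[]}     _                  = refl
ones-unique {suc k} {x ∷ xs} (l , p ∷ ps , s) = cong₂ _∷_ (sym x≡1) (ones-unique (l′ , ps , s′))
  where
  l′ : length xs ≡ k
  l′ = suc-injective l
  x≡1 : x ≡ 1
  x≡1 = ≤-antisym (+-cancelʳ-≤ (sum xs) x 1
          (subst (_≤ 1 + sum xs) (sym s) (s≤s (subst (_≤ sum xs) l′ (length≤sum ps))))) p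
  s′ : sum xs ≡ k
  s′ = suc-injective (trans (cong (_+ sum xs) (sym x≡1)) s)

single-unique : ∀ {n xs} → IsComp n 1 xs → n ∷ [] ≡ xs
single-unique {xs = x ∷ []} (_ , _ , s) = cong (_∷ []) (trans (sym s) (+-identityʳ x))

comp-snoc : ∀ {m n k ys x} → IsComp m k ys → 1 ≤ x → m + x ≡ n → IsComp n (suc k) (ys ∷ʳ x)
comp-snoc {k = k} {ys} {x} (l , ps , s) px e =
  trans (length-++ ys) (trans (cong (_+ 1) l) (+-comm k 1)) ,
  All.++⁺ ps (px ∷ []) ,
  trans (sum-++ ys (x ∷ [])) (trans (cong₂ _+_ s (+-identityʳ x)) e)

comp-unsnoc : ∀ {n k ys x} → IsComp n (suc k) (ys ∷ʳ x) → IsComp (sum ys) k ys × 1 ≤ x × sum ys + x ≡ n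
comp-unsnoc {ys = ys} {x} (l , ps , s) with All.++⁻ ys ps
... | pys , px ∷ [] =
  (suc-injective (trans (+-comm 1 (length ys)) (trans (sym (length-++ ys)) l)) , pys , refl) , px ,
  trans (cong (sum ys +_) (sym (+-identityʳ x))) (trans (sym (sum-++ ys (x ∷ []))) s)

incLast-snoc : ∀ ys x → incLast (ys ∷ʳ x) ≡ ys ∷ʳ suc x
incLast-snoc []           x = refl
incLast-snoc (y ∷ [])     x = refl
incLast-snoc (y ∷ z ∷ ys) x = cong (y ∷_) (incLast-snoc (z ∷ ys) x)

incLast-comp : ∀ {m k xs} → IsComp m (suc k) xs → IsComp (suc m) (suc k) (incLast xs)
incLast-comp {xs = xs} c with initLast xs
incLast-comp (() , _)  | []
incLast-comp c         | ys ∷ʳ′ x with comp-unsnoc c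
... | cys , px , s = subst (IsComp _ _) (sym (incLast-snoc ys x))
                       (comp-snoc cys (s≤s z≤n) (trans (+-suc (sum ys) x) (cong suc s)))

incLast-injective : ∀ {m m′ k xs xs′} → IsComp m (suc k) xs → IsComp m′ (suc k) xs′ →
                    incLast xs ≡ incLast xs′ → xs ≡ xs′
incLast-injective {xs = xs} {xs′} c c′ e with initLast xs | initLast xs′
incLast-injective (() , _) _ e | [] | _
incLast-injective _ (() , _) e | _  | []
incLast-injective _ _ e | ys ∷ʳ′ x | ys′ ∷ʳ′ x′
  with ∷ʳ-injective ys ys′ (trans (sym (incLast-snoc ys x)) (trans e (incLast-snoc ys′ x′)))
... | refl , refl = refl

incLast≢snoc1 : ∀ {m k xs} ys → IsComp m (suc k) xs → incLast xs ≢ ys ∷ʳ 1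
incLast≢snoc1 {xs = xs} ys c e with initLast xs
incLast≢snoc1 ys (() , _) e | []
incLast≢snoc1 ys c        e | zs ∷ʳ′ x with proj₁ (proj₂ (comp-unsnoc c))
... | px = 1+n≰n (subst (1 ≤_) (suc-injective (∷ʳ-injectiveʳ zs ys (trans (sym (incLast-snoc zs x)) e))) px)

Raised Extended : ℕ → ℕ → List ℕ → Set
Raised    m k xs = Σ (List ℕ) (λ ys → IsComp m (suc k) ys × incLast ys ≡ xs)
Extended  m k xs = Σ (List ℕ) (λ ys → IsComp m k ys × ys ∷ʳ 1 ≡ xs)

comp-cases : ∀ {m k xs} → IsComp (suc m) (suc k) xs → Raised m k xs ⊎ Extended m k xs
comp-cases {xs = xs} c with initLast xs
comp-cases (() , _) | []
comp-cases c | ys ∷ʳ′ zero = ⊥-elim (1+n≰n (proj₁ (proj₂ (comp-unsnoc c))))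
comp-cases c | ys ∷ʳ′ suc zero =
  let (cys , _ , s) = comp-unsnoc c in
  inj₂ (ys , subst (λ n → IsComp n _ ys) (suc-injective (trans (+-comm 1 (sum ys)) s)) cys , refl)
comp-cases c | ys ∷ʳ′ suc (suc x) =
  let (cys , _ , s) = comp-unsnoc c in
  inj₁ (ys ∷ʳ suc x , comp-snoc cys (s≤s z≤n) (suc-injective (trans (sym (+-suc (sum ys) (suc x))) s)) ,
        incLast-snoc ys (suc x))

raised-comp : ∀ {m k xs} → Raised m k xs → IsComp (suc m) (suc k) xs
raised-comp (ys , c , refl) = incLast-comp c

extended-comp : ∀ {m k xs} → Extended m k xs → IsComp (suc m) (suc k) xs
extended-comp {m} {k} (ys , c , refl) = comp-snoc c (s≤s z≤n) (+-comm m 1)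

raised-extended-disjoint : ∀ {m k xs} → Raised m k xs → Extended m k xs → ⊥
raised-extended-disjoint (ys , c , refl) (zs , _ , e) = incLast≢snoc1 zs c (sym e)

CompositionsRanked : ℕ → ℕ → Set
CompositionsRanked m k = BijectionOn (Below ((m ∸ 1) C (k ∸ 1))) (IsComp m k) (unrankComposition m k)

unrankComposition-one-part : ∀ m → unrankComposition (suc m) 1 0 ≡ suc m ∷ []
unrankComposition-one-part zero    = refl
unrankComposition-one-part (suc m) = cong incLast (unrankComposition-one-part m)

unrankComposition-one : ∀ m → CompositionsRanked (suc m) 1
unrankComposition-one m =
  bij-cong (λ { (s≤s z≤n) → sym (unrankComposition-one-part m) })
    (single-bij (refl , s≤s z≤n ∷ [] , +-identityʳ (suc m)) single-unique)

unrankComposition-all-ones : ∀ m → CompositionsRanked (suc (suc m)) (suc (suc m))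
unrankComposition-all-ones m =
  bij-resize (sym (nCn≡1 (suc m)))
    (bij-cong (λ _ → sym (if-true (≡⇒≡ᵇ (suc (suc m)) (suc (suc m)) refl)))
      (single-bij (ones-comp (suc (suc m))) ones-unique))

-- 2 ≤ k ≤ m: unless k = m, the two branches of the algorithm enumerate the
-- raised and the extended compositions, and C(m-1, k-1) = C(m-2, k-1) + C(m-2, k-2).
unrankComposition-step : ∀ m j → suc (suc j) ≤ suc (suc m) →
  (suc (suc j) ≤ suc m → CompositionsRanked (suc m) (suc (suc j))) → CompositionsRanked (suc m) (suc j) →
  CompositionsRanked (suc (suc m)) (suc (suc j))
unrankComposition-step m j k≤ raise extend with m ≟ j
... | yes refl = unrankComposition-all-ones m
... | no m≢j =
  bij-resize (trans (+-comm (m C suc j) (m C j)) (nCk+nC[k+1]≡[n+1]C[k+1] m j))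
    (bij-cong (λ _ → sym (if-false (m≢j ∘ suc-injective ∘ suc-injective ∘ ≡ᵇ⇒≡ _ _)))
      (bij-retarget [ raised-comp , extended-comp ]′ (comp-cases {suc m})
        (split-bij
          (∘-bij (raise (≤∧≢⇒< (≤-pred k≤) (m≢j ∘ sym ∘ suc-injective))) (image-bij incLast-injective))
          (∘-bij extend (image-bij (λ _ _ → ∷ʳ-injectiveˡ _ _)))
          raised-extended-disjoint)))

unrankComposition-bij : ∀ m k → 1 ≤ k → k ≤ m → CompositionsRanked m k
unrankComposition-bij (suc m)       (suc zero)    _ _        = unrankComposition-one m
unrankComposition-bij (suc zero)    (suc (suc j)) _ (s≤s ())
unrankComposition-bij (suc (suc m)) (suc (suc j)) _ k≤ =
  unrankComposition-step m j k≤ (unrankComposition-bij (suc m) (suc (suc j)) (s≤s z≤n))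
    (unrankComposition-bij (suc m) (suc j) (s≤s z≤n) (≤-pred k≤))

-- f (k-1) + … + f 1 + f 0, accumulated from the top as the scan of UnrankTree does.
sumDown : (ℕ → ℕ) → ℕ → ℕ
sumDown f zero    = 0
sumDown f (suc k) = f k + sumDown f k

sumDown-peel : ∀ f k → sumDown f (suc k) ≡ f 0 + sumDown (λ j → f (suc j)) k
sumDown-peel f zero    = refl
sumDown-peel f (suc k) = begin
  f (suc k) + sumDown f (suc k)                        ≡⟨ cong (f (suc k) +_) (sumDown-peel f k) ⟩
  f (suc k) + (f 0 + sumDown (λ j → f (suc j)) k)      ≡⟨ +-comm (f (suc k)) _ ⟩
  (f 0 + sumDown (λ j → f (suc j)) k) + f (suc k)      ≡⟨ +-assoc (f 0) _ _ ⟩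
  f 0 + (sumDown (λ j → f (suc j)) k + f (suc k))      ≡⟨ cong (f 0 +_) (+-comm _ (f (suc k))) ⟩
  f 0 + sumDown (λ j → f (suc j)) (suc k)              ∎
  where open ≡-Reasoning

sumFin-cong : ∀ {k} {f h : Fin k → ℕ} → (∀ i → f i ≡ h i) → sumFin f ≡ sumFin h
sumFin-cong {zero}  e = refl
sumFin-cong {suc k} e = cong₂ _+_ (e Fin.zero) (sumFin-cong (λ i → e (Fin.suc i)))

sumFin-sumDown : ∀ f k → sumFin {k} (λ i → f (toℕ i)) ≡ sumDown f k
sumFin-sumDown f zero    = refl
sumFin-sumDown f (suc k) = trans (cong (f 0 +_) (sumFin-sumDown (λ j → f (suc j)) k)) (sym (sumDown-peel f k))

lookup-∷ʳ : ∀ {A : Set} {n} (xs : Vec A n) y (i : Fin (suc n)) →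
  (toℕ i ≡ n × Vec.lookup (xs Vec.∷ʳ y) i ≡ y) ⊎
  Σ (Fin n) (λ j → toℕ j ≡ toℕ i × Vec.lookup (xs Vec.∷ʳ y) i ≡ Vec.lookup xs j)
lookup-∷ʳ Vec.[]       y Fin.zero    = inj₁ (refl , refl)
lookup-∷ʳ (x Vec.∷ xs) y Fin.zero    = inj₂ (Fin.zero , refl , refl)
lookup-∷ʳ (x Vec.∷ xs) y (Fin.suc i) with lookup-∷ʳ xs y i
... | inj₁ (e , l)     = inj₁ (cong suc e , l)
... | inj₂ (j , e , l) = inj₂ (Fin.suc j , cong suc e , l)

gNext : ℕ → ℕ
gNext m = sumFin (λ (i : Fin (suc m)) → (suc m C toℕ i) * Vec.lookup (gs (suc m)) i)

g-next : ∀ m → g (suc (suc m)) ≡ gNext m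
g-next m = Vec.last-∷ʳ (gNext m) (gs (suc m))

gs-lookup : ∀ n (i : Fin n) → Vec.lookup (gs n) i ≡ g (suc (toℕ i))
gs-lookup (suc zero)    Fin.zero = refl
gs-lookup (suc (suc m)) i =
  [ (λ (i≡ , l) → trans l (trans (sym (g-next m)) (cong (λ j → g (suc j)) (sym i≡))))
  , (λ (j , j≡ , l) → trans l (trans (gs-lookup (suc m) j) (cong (λ j → g (suc j)) j≡)))
  ]′ (lookup-∷ʳ (gs (suc m)) (gNext m) i)

-- The k-th block of UnrankTree(n, ·): trees with k leaves under compositions
-- of n into k parts, C(n-1, k-1) g_k of them.
block : ℕ → ℕ → ℕ
block n k = ((n ∸ 1) C (k ∸ 1)) * g k

g-blocks : ∀ m → g (suc (suc m)) ≡ sumDown (λ j → block (suc (suc m)) (suc j)) (suc m)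
g-blocks m = begin
  g (suc (suc m))                                                   ≡⟨ g-next m ⟩
  gNext m                                                           ≡⟨ sumFin-cong (λ i → cong ((suc m C toℕ i) *_) (gs-lookup (suc m) i)) ⟩
  sumFin (λ (i : Fin (suc m)) → block (suc (suc m)) (suc (toℕ i)))  ≡⟨ sumFin-sumDown (λ j → block (suc (suc m)) (suc j)) (suc m) ⟩
  sumDown (λ j → block (suc (suc m)) (suc j)) (suc m)               ∎
  where open ≡-Reasoning

+-<ᵇ : ∀ a {s x} → (a + s <ᵇ a + x) ≡ (s <ᵇ x)
+-<ᵇ zero    = refl
+-<ᵇ (suc a) = +-<ᵇ a

scan-shift : ∀ n k a b s → scan n k (a + b) (a + s) ≡ scan n k b s
scan-shift n zero    a b s = refl
scan-shift n (suc k) a b s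
  rewrite +-assoc a b (block n (suc k)) | +-<ᵇ a {s} {b + block n (suc k)}
        | [m+n]∸[m+o]≡n∸o a s b | scan-shift n k a (b + block n (suc k)) s = refl

scan-tail : ∀ n k {c s} → c ≤ s → scan n k c s ≡ scan n k 0 (s ∸ c)
scan-tail n k {c} {s} c≤s = begin
  scan n k c s                    ≡⟨ cong₂ (scan n k) (sym (+-identityʳ c)) (sym (m+[n∸m]≡n c≤s)) ⟩
  scan n k (c + 0) (c + (s ∸ c))  ≡⟨ scan-shift n k c 0 (s ∸ c) ⟩
  scan n k 0 (s ∸ c)              ∎
  where open ≡-Reasoning

InBlock : ℕ → ℕ → ℕ × ℕ → Set
InBlock n K (k , r) = (1 ≤ k × k < suc K) × r < block n k

scan-bij : ∀ n K → BijectionOn (Below (sumDown (λ j → block n (suc j)) K)) (InBlock n K) (scan n K 0)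
scan-bij n zero = record
  { maps = λ ()
  ; injective = λ ()
  ; onto = λ { ((1≤k , s≤s k≤0) , _) → ⊥-elim (<⇒≱ 1≤k k≤0) }
  }
scan-bij n (suc K) =
  bij-cong (λ {s} _ → scan-split s)
    (bij-retarget [ top-in , (λ { ((1≤k , k<) , r<) → (1≤k , m≤n⇒m≤1+n k<) , r< }) ]′ classify
      (split-bij top-bij (scan-bij n K)
        (λ { (refl , _) ((_ , k<) , _) → 1+n≰n (≤-pred k<) })))
  where
  c = block n (suc K)

  top : ℕ → ℕ × ℕ
  top r = suc K , r

  Top : ℕ × ℕ → Set
  Top (k , r) = k ≡ suc K × r < block n k

  top-bij : BijectionOn (Below c) Top top
  top-bij = record
    { maps      = λ r<c → refl , r<c
    ; injective = λ _ _ → cong proj₂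
    ; onto      = λ { {(k , r)} (refl , r<c) → r , r<c , refl }
    }

  top-in : ∀ {p} → Top p → InBlock n (suc K) p
  top-in (refl , r<c) = (s≤s z≤n , ≤-refl) , r<c

  classify : ∀ {p} → InBlock n (suc K) p → Top p ⊎ InBlock n K p
  classify {k , r} ((1≤k , k<) , r<) with k ≟ suc K
  ... | yes k≡ = inj₁ (k≡ , r<)
  ... | no  k≢ = inj₂ ((1≤k , ≤∧≢⇒< (≤-pred k<) k≢) , r<)

  scan-split : ∀ s → splitAt c top (scan n K 0) s ≡ scan n (suc K) 0 s
  scan-split s with s <? c
  ... | yes s<c = trans (splitAt-below top (scan n K 0) s<c) (sym (if-true (<⇒<ᵇ s<c)))
  ... | no  s≮c = trans (splitAt-above top (scan n K 0) (≮⇒≥ s≮c))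
                    (trans (sym (scan-tail n K (≮⇒≥ s≮c))) (sym (if-false (s≮c ∘ <ᵇ⇒< s c))))

<ᵇ≡true : ∀ {m n} → (m <ᵇ n) ≡ true → m < n
<ᵇ≡true {m} {n} e = <ᵇ⇒< m n (subst Bool.T (sym e) _)

<ᵇ≡false : ∀ {m n} → (m <ᵇ n) ≡ false → n ≤ m
<ᵇ≡false {m} {n} e = ≮⇒≥ (λ m<n → subst Bool.T e (<⇒<ᵇ m<n))

Labelled : ℕ → Tree → Set
Labelled L t = LabelsIn 0 L t × (∀ v → 1 ≤ v → v ≤ L → Occurs v t)

mutual
  occurs-above : ∀ {lo hi v t} → LabelsIn lo hi t → Occurs v t → lo < v
  occurs-above (node lo<ℓ _ _) here      = lo<ℓ
  occurs-above (node lo<ℓ _ l) (there o) = <-trans lo<ℓ (occurs-aboves l o)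

  occurs-aboves : ∀ {lo hi v ts} → All (LabelsIn lo hi) ts → Any (Occurs v) ts → lo < v
  occurs-aboves (l ∷ _)  (here o)  = occurs-above l o
  occurs-aboves (_ ∷ ls) (there o) = occurs-aboves ls o

mutual
  maxLabel-≤ : ∀ {lo L t} → LabelsIn lo L t → maxLabel t ≤ L
  maxLabel-≤ leaf           = z≤n
  maxLabel-≤ (node _ ℓ≤L l) = ⊔-lub ℓ≤L (maxLabels-≤ l)

  maxLabels-≤ : ∀ {lo L ts} → All (LabelsIn lo L) ts → maxLabels ts ≤ L
  maxLabels-≤ []       = z≤n
  maxLabels-≤ (l ∷ ls) = ⊔-lub (maxLabel-≤ l) (maxLabels-≤ ls)

mutual
  occurs-≤-maxLabel : ∀ {v t} → Occurs v t → v ≤ maxLabel t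
  occurs-≤-maxLabel {v} {node .v ts} here      = m≤m⊔n v (maxLabels ts)
  occurs-≤-maxLabel {v} {node ℓ ts}  (there o) = ≤-trans (occurs-≤-maxLabels o) (m≤n⊔m ℓ (maxLabels ts))

  occurs-≤-maxLabels : ∀ {v ts} → Any (Occurs v) ts → v ≤ maxLabels ts
  occurs-≤-maxLabels {ts = t ∷ ts} (here o)  = ≤-trans (occurs-≤-maxLabel o) (m≤m⊔n (maxLabel t) (maxLabels ts))
  occurs-≤-maxLabels {ts = t ∷ ts} (there o) = ≤-trans (occurs-≤-maxLabels o) (m≤n⊔m (maxLabel t) (maxLabels ts))

labelled-max : ∀ {L t} → Labelled L t → maxLabel t ≡ L
labelled-max {zero}  (l , _)   = n≤0⇒n≡0 (maxLabel-≤ l)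
labelled-max {suc L} (l , occ) = ≤-antisym (maxLabel-≤ l) (occurs-≤-maxLabel (occ (suc L) (s≤s z≤n) ≤-refl))

leafCounts-replicate : ∀ n → leafCounts (replicate n leaf) ≡ n
leafCounts-replicate zero    = refl
leafCounts-replicate (suc n) = cong suc (leafCounts-replicate n)

top-children : ∀ {K ts} → All (LabelsIn (suc K) (suc K)) ts → replicate (length ts) leaf ≡ ts
top-children []                       = refl
top-children (leaf ∷ ls)              = cong (leaf ∷_) (top-children ls)
top-children (node K<ℓ ℓ≤K _ ∷ _)     = ⊥-elim (<⇒≱ K<ℓ ℓ≤K)

All-replicate : ∀ {P : Tree → Set} → P leaf → ∀ n → All P (replicate n leaf)
All-replicate p zero    = []
All-replicate p (suc n) = p ∷ All-replicate p n

mutual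
  schroder-leaves : ∀ {t} → Schroder t → 1 ≤ leafCount t
  schroder-leaves leaf          = s≤s z≤n
  schroder-leaves (node 2≤ ss) = ≤-trans (≤-trans (s≤s z≤n) 2≤) (schroders-leaves ss)

  schroders-leaves : ∀ {ts} → All Schroder ts → length ts ≤ leafCounts ts
  schroders-leaves []       = z≤n
  schroders-leaves (s ∷ ss) = +-mono-≤ (schroder-leaves s) (schroders-leaves ss)

window : (ℕ → ℕ) → ℕ → ℕ → List ℕ
window a p zero    = []
window a p (suc k) = a p ∷ window a (suc p) k

window-++ : ∀ a p m n → window a p (m + n) ≡ window a p m ++ window a (p + m) n
window-++ a p zero    n = cong (λ q → window a q n) (sym (+-identityʳ p))
window-++ a p (suc m) n =
  cong (a p ∷_) (trans (window-++ a (suc p) m n) (cong (λ q → window a (suc p) m ++ window a q n) (sym (+-suc p m))))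

length-window : ∀ a p k → length (window a p k) ≡ k
length-window a p zero    = refl
length-window a p (suc k) = cong suc (length-window a (suc p) k)

++-cancel-length : ∀ (xs ys : List ℕ) {xs′ ys′} → length xs ≡ length ys → xs ++ xs′ ≡ ys ++ ys′ →
                   xs ≡ ys × xs′ ≡ ys′
++-cancel-length []       []       _ e = refl , e
++-cancel-length (x ∷ xs) (y ∷ ys) l e with ∷-injective e
... | refl , e′ = Prod.map₁ (cong (x ∷_)) (++-cancel-length xs ys (suc-injective l) e′)

window-split : ∀ a p k₁ k₂ xs ys → length xs ≡ k₁ → window a p (k₁ + k₂) ≡ xs ++ ys →
               window a p k₁ ≡ xs × window a (p + k₁) k₂ ≡ ys
window-split a p k₁ k₂ xs ys l e =
  ++-cancel-length (window a p k₁) xs (trans (length-window a p k₁) (sym l)) (trans (sym (window-++ a p k₁ k₂)) e)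

module Graft (a : ℕ → ℕ) (lab : ℕ) where

  grafted : Tree → ℕ → Tree
  grafted t p = proj₁ (graftAt a lab t p)

  grafteds : List Tree → ℕ → List Tree
  grafteds ts p = proj₁ (graftsAt a lab ts p)

  mutual
    graftAt-next : ∀ t p → proj₂ (graftAt a lab t p) ≡ p + leafCount t
    graftAt-next leaf        p = sym (+-comm p 1)
    graftAt-next (node ℓ ts) p = graftsAt-next ts p

    graftsAt-next : ∀ ts p → proj₂ (graftsAt a lab ts p) ≡ p + leafCounts ts
    graftsAt-next []       p = sym (+-identityʳ p)
    graftsAt-next (t ∷ ts) p = begin
      proj₂ (graftsAt a lab ts (proj₂ (graftAt a lab t p)))  ≡⟨ graftsAt-next ts _ ⟩
      proj₂ (graftAt a lab t p) + leafCounts ts              ≡⟨ cong (_+ leafCounts ts) (graftAt-next t p) ⟩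
      p + leafCount t + leafCounts ts                        ≡⟨ +-assoc p (leafCount t) (leafCounts ts) ⟩
      p + (leafCount t + leafCounts ts)                      ∎
      where open ≡-Reasoning

  window-next : ∀ t ts p → window a (proj₂ (graftAt a lab t p)) (leafCounts ts) ≡ window a (p + leafCount t) (leafCounts ts)
  window-next t ts p = cong (λ q → window a q (leafCounts ts)) (graftAt-next t p)

  graftsAt-length : ∀ ts p → length (grafteds ts p) ≡ length ts
  graftsAt-length []       p = refl
  graftsAt-length (t ∷ ts) p = cong suc (graftsAt-length ts _)

  module _ (a-pos : ∀ q → 1 ≤ a q) where

    mutual
      graftAt-leafCount : ∀ t p → leafCount (grafted t p) ≡ sum (window a p (leafCount t))
      graftAt-leafCount leaf        p with 1 <ᵇ a p in e
      ... | true  = trans (leafCounts-replicate (a p)) (sym (+-identityʳ (a p)))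
      ... | false = sym (trans (+-identityʳ (a p)) (≤-antisym (<ᵇ≡false e) (a-pos p)))
      graftAt-leafCount (node ℓ ts) p = graftsAt-leafCount ts p

      graftsAt-leafCount : ∀ ts p → leafCounts (grafteds ts p) ≡ sum (window a p (leafCounts ts))
      graftsAt-leafCount []       p = refl
      graftsAt-leafCount (t ∷ ts) p = begin
        leafCount (grafted t p) + leafCounts (grafteds ts _)
          ≡⟨ cong₂ _+_ (graftAt-leafCount t p) (trans (graftsAt-leafCount ts _) (cong sum (window-next t ts p))) ⟩
        sum (window a p (leafCount t)) + sum (window a (p + leafCount t) (leafCounts ts))
          ≡⟨ sym (sum-++ (window a p (leafCount t)) _) ⟩
        sum (window a p (leafCount t) ++ window a (p + leafCount t) (leafCounts ts))
          ≡⟨ cong sum (sym (window-++ a p (leafCount t) (leafCounts ts))) ⟩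
        sum (window a p (leafCount t + leafCounts ts))
          ∎
        where open ≡-Reasoning

  mutual
    graftAt-schroder : ∀ {t} p → Schroder t → Schroder (grafted t p)
    graftAt-schroder p leaf with 1 <ᵇ a p in e
    ... | true  = node (subst (2 ≤_) (sym (length-replicate (a p))) (<ᵇ≡true e)) (All-replicate leaf (a p))
    ... | false = leaf
    graftAt-schroder {node ℓ ts} p (node 2≤ ss) =
      node (subst (2 ≤_) (sym (graftsAt-length ts p)) 2≤) (graftsAt-schroder p ss)

    graftsAt-schroder : ∀ {ts} p → All Schroder ts → All Schroder (grafteds ts p)
    graftsAt-schroder p []       = []
    graftsAt-schroder p (s ∷ ss) = graftAt-schroder p s ∷ graftsAt-schroder _ ss

  mutual
    graftAt-occurs : ∀ {v t} p → Occurs v t → Occurs v (grafted t p)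
    graftAt-occurs p here      = here
    graftAt-occurs p (there o) = there (graftsAt-occurs p o)

    graftsAt-occurs : ∀ {v ts} p → Any (Occurs v) ts → Any (Occurs v) (grafteds ts p)
    graftsAt-occurs p (here o)  = here (graftAt-occurs p o)
    graftsAt-occurs p (there o) = there (graftsAt-occurs _ o)

  mutual
    graftAt-occurs-new : ∀ t p → Any (2 ≤_) (window a p (leafCount t)) → Occurs lab (grafted t p)
    graftAt-occurs-new leaf        p (here 2≤) with 1 <ᵇ a p in e
    ... | true  = here
    ... | false = ⊥-elim (<⇒≱ 2≤ (<ᵇ≡false e))
    graftAt-occurs-new (node ℓ ts) p big = there (graftsAt-occurs-new ts p big)

    graftsAt-occurs-new : ∀ ts p → Any (2 ≤_) (window a p (leafCounts ts)) → Any (Occurs lab) (grafteds ts p)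
    graftsAt-occurs-new (t ∷ ts) p big
      with Any.++⁻ (window a p (leafCount t)) (subst (Any (2 ≤_)) (window-++ a p (leafCount t) (leafCounts ts)) big)
    ... | inj₁ big₁ = here (graftAt-occurs-new t p big₁)
    ... | inj₂ big₂ = there (graftsAt-occurs-new ts _ (subst (Any (2 ≤_)) (sym (window-next t ts p)) big₂))

mutual
  prune : ℕ → Tree → Tree
  prune M leaf = leaf
  prune M (node ℓ ts) with ℓ ≟ M
  ... | yes _ = leaf
  ... | no  _ = node ℓ (prunes M ts)

  prunes : ℕ → List Tree → List Tree
  prunes M []       = []
  prunes M (t ∷ ts) = prune M t ∷ prunes M ts

mutual
  arities : ℕ → Tree → List ℕ
  arities M leaf = 1 ∷ []
  arities M (node ℓ ts) with ℓ ≟ M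
  ... | yes _ = length ts ∷ []
  ... | no  _ = aritiess M ts

  aritiess : ℕ → List Tree → List ℕ
  aritiess M []       = []
  aritiess M (t ∷ ts) = arities M t ++ aritiess M ts

module _ (a : ℕ → ℕ) (L : ℕ) where
  open Graft a (suc L)

  mutual
    graftAt-labels : ∀ {lo t} p → lo < suc L → LabelsIn lo L t → LabelsIn lo (suc L) (grafted t p)
    graftAt-labels p lo<L+1 leaf with 1 <ᵇ a p
    ... | true  = node lo<L+1 ≤-refl (All-replicate leaf (a p))
    ... | false = leaf
    graftAt-labels p _ (node lo<ℓ ℓ≤L ls) = node lo<ℓ (m≤n⇒m≤1+n ℓ≤L) (graftsAt-labels p (s≤s ℓ≤L) ls)

    graftsAt-labels : ∀ {lo ts} p → lo < suc L → All (LabelsIn lo L) ts → All (LabelsIn lo (suc L)) (grafteds ts p)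
    graftsAt-labels p _      []       = []
    graftsAt-labels p lo<L+1 (l ∷ ls) = graftAt-labels p lo<L+1 l ∷ graftsAt-labels _ lo<L+1 ls

  mutual
    prune-graftAt : ∀ {lo t} p → LabelsIn lo L t → prune (suc L) (grafted t p) ≡ t
    prune-graftAt p leaf with 1 <ᵇ a p
    ... | false = refl
    ... | true with suc L ≟ suc L
    ...   | yes _  = refl
    ...   | no  ne = ⊥-elim (ne refl)
    prune-graftAt p (node {ℓ} _ ℓ≤L ls) with ℓ ≟ suc L
    ... | yes refl = ⊥-elim (1+n≰n ℓ≤L)
    ... | no  _    = cong (node ℓ) (prune-graftsAt p ls)

    prune-graftsAt : ∀ {lo ts} p → All (LabelsIn lo L) ts → prunes (suc L) (grafteds ts p) ≡ ts
    prune-graftsAt p []       = refl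
    prune-graftsAt p (l ∷ ls) = cong₂ _∷_ (prune-graftAt p l) (prune-graftsAt _ ls)

  module _ (a-pos : ∀ q → 1 ≤ a q) where

    mutual
      arities-graftAt : ∀ {lo t} p → LabelsIn lo L t → arities (suc L) (grafted t p) ≡ window a p (leafCount t)
      arities-graftAt p leaf with 1 <ᵇ a p in e
      ... | false = cong (_∷ []) (≤-antisym (a-pos p) (<ᵇ≡false e))
      ... | true with suc L ≟ suc L
      ...   | yes _  = cong (_∷ []) (length-replicate (a p))
      ...   | no  ne = ⊥-elim (ne refl)
      arities-graftAt p (node {ℓ} _ ℓ≤L ls) with ℓ ≟ suc L
      ... | yes refl = ⊥-elim (1+n≰n ℓ≤L)
      ... | no  _    = aritiess-graftsAt p ls

      aritiess-graftsAt : ∀ {lo ts} p → All (LabelsIn lo L) ts → aritiess (suc L) (grafteds ts p) ≡ window a p (leafCounts ts)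
      aritiess-graftsAt p [] = refl
      aritiess-graftsAt {ts = t ∷ ts} p (l ∷ ls) = begin
        arities (suc L) (grafted t p) ++ aritiess (suc L) (grafteds ts _)
          ≡⟨ cong₂ _++_ (arities-graftAt p l) (trans (aritiess-graftsAt _ ls) (window-next t ts p)) ⟩
        window a p (leafCount t) ++ window a (p + leafCount t) (leafCounts ts)
          ≡⟨ sym (window-++ a p (leafCount t) (leafCounts ts)) ⟩
        window a p (leafCount t + leafCounts ts)
          ∎
        where open ≡-Reasoning

mutual
  arities-length : ∀ M t → length (arities M t) ≡ leafCount (prune M t)
  arities-length M leaf = refl
  arities-length M (node ℓ ts) with ℓ ≟ M
  ... | yes _ = refl
  ... | no  _ = aritiess-length M ts

  aritiess-length : ∀ M ts → length (aritiess M ts) ≡ leafCounts (prunes M ts)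
  aritiess-length M []       = refl
  aritiess-length M (t ∷ ts) = trans (length-++ (arities M t)) (cong₂ _+_ (arities-length M t) (aritiess-length M ts))

mutual
  graftAt-prune : ∀ a K {lo t} p → LabelsIn lo (suc K) t → Schroder t →
                  window a p (leafCount (prune (suc K) t)) ≡ arities (suc K) t →
                  Graft.grafted a (suc K) (prune (suc K) t) p ≡ t
  graftAt-prune a K p leaf leaf w with 1 <ᵇ a p in e
  ... | true  = ⊥-elim (<⇒≢ (<ᵇ≡true e) (sym (proj₁ (∷-injective w))))
  ... | false = refl
  graftAt-prune a K p (node {ℓ} {ts} _ _ ls) (node 2≤ ss) w with ℓ ≟ suc K
  ... | no  _    = cong (node ℓ) (graftsAt-prune a K p ls ss w)
  ... | yes refl with 1 <ᵇ a p in e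
  ...   | true  = cong (node (suc K)) (trans (cong (λ n → replicate n leaf) (proj₁ (∷-injective w))) (top-children ls))
  ...   | false = ⊥-elim (<⇒≱ (subst (2 ≤_) (sym (proj₁ (∷-injective w))) 2≤) (<ᵇ≡false e))

  graftsAt-prune : ∀ a K {lo ts} p → All (LabelsIn lo (suc K)) ts → All Schroder ts →
                   window a p (leafCounts (prunes (suc K) ts)) ≡ aritiess (suc K) ts →
                   Graft.grafteds a (suc K) (prunes (suc K) ts) p ≡ ts
  graftsAt-prune a K p [] [] w = refl
  graftsAt-prune a K {ts = t ∷ ts} p (l ∷ ls) (s ∷ ss) w =
    cong₂ _∷_ (graftAt-prune a K p l s (proj₁ w₁₂))
              (graftsAt-prune a K _ ls ss (trans (Graft.window-next a (suc K) (prune (suc K) t) (prunes (suc K) ts) p) (proj₂ w₁₂)))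
    where
    w₁₂ = window-split a p _ _ (arities (suc K) t) (aritiess (suc K) ts) (arities-length (suc K) t) w

mutual
  prune-schroder : ∀ M {t} → Schroder t → Schroder (prune M t)
  prune-schroder M leaf = leaf
  prune-schroder M {node ℓ ts} (node 2≤ ss) with ℓ ≟ M
  ... | yes _ = leaf
  ... | no  _ = node (subst (2 ≤_) (sym (prunes-length M ts)) 2≤) (prunes-schroder M ss)

  prunes-schroder : ∀ M {ts} → All Schroder ts → All Schroder (prunes M ts)
  prunes-schroder M []       = []
  prunes-schroder M (s ∷ ss) = prune-schroder M s ∷ prunes-schroder M ss

  prunes-length : ∀ M ts → length (prunes M ts) ≡ length ts
  prunes-length M []       = refl
  prunes-length M (t ∷ ts) = cong suc (prunes-length M ts)

mutual
  prune-labels : ∀ K {lo t} → LabelsIn lo (suc K) t → LabelsIn lo K (prune (suc K) t)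
  prune-labels K leaf = leaf
  prune-labels K (node {ℓ} lo<ℓ ℓ≤ ls) with ℓ ≟ suc K
  ... | yes _  = leaf
  ... | no  ne = node lo<ℓ (≤-pred (≤∧≢⇒< ℓ≤ ne)) (prunes-labels K ls)

  prunes-labels : ∀ K {lo ts} → All (LabelsIn lo (suc K)) ts → All (LabelsIn lo K) (prunes (suc K) ts)
  prunes-labels K []       = []
  prunes-labels K (l ∷ ls) = prune-labels K l ∷ prunes-labels K ls

mutual
  prune-occurs : ∀ K {lo v t} → v ≤ K → LabelsIn lo (suc K) t → Occurs v t → Occurs v (prune (suc K) t)
  prune-occurs K {v = v} v≤K (node _ _ _) here with v ≟ suc K
  ... | yes refl = ⊥-elim (1+n≰n v≤K)
  ... | no  _    = here
  prune-occurs K {v = v} v≤K (node {ℓ} _ _ ls) (there o) with ℓ ≟ suc K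
  ... | yes refl = ⊥-elim (<⇒≱ (occurs-aboves ls o) (m≤n⇒m≤1+n v≤K))
  ... | no  _    = there (prunes-occurs K v≤K ls o)

  prunes-occurs : ∀ K {lo v ts} → v ≤ K → All (LabelsIn lo (suc K)) ts → Any (Occurs v) ts → Any (Occurs v) (prunes (suc K) ts)
  prunes-occurs K v≤K (l ∷ _)  (here o)  = here (prune-occurs K v≤K l o)
  prunes-occurs K v≤K (_ ∷ ls) (there o) = there (prunes-occurs K v≤K ls o)

mutual
  arities-sum : ∀ K {lo t} → LabelsIn lo (suc K) t → sum (arities (suc K) t) ≡ leafCount t
  arities-sum K leaf = refl
  arities-sum K (node {ℓ} {ts} _ _ ls) with ℓ ≟ suc K
  ... | yes refl = trans (+-identityʳ (length ts))
                     (trans (sym (leafCounts-replicate (length ts))) (cong leafCounts (top-children ls)))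
  ... | no  _    = aritiess-sum K ls

  aritiess-sum : ∀ K {lo ts} → All (LabelsIn lo (suc K)) ts → sum (aritiess (suc K) ts) ≡ leafCounts ts
  aritiess-sum K [] = refl
  aritiess-sum K {ts = t ∷ _} (l ∷ ls) = trans (sum-++ (arities (suc K) t) _) (cong₂ _+_ (arities-sum K l) (aritiess-sum K ls))

mutual
  arities-pos : ∀ M {t} → Schroder t → All (1 ≤_) (arities M t)
  arities-pos M leaf = s≤s z≤n ∷ []
  arities-pos M {node ℓ _} (node 2≤ ss) with ℓ ≟ M
  ... | yes _ = ≤-trans (s≤s z≤n) 2≤ ∷ []
  ... | no  _ = aritiess-pos M ss

  aritiess-pos : ∀ M {ts} → All Schroder ts → All (1 ≤_) (aritiess M ts)
  aritiess-pos M []       = []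
  aritiess-pos M (s ∷ ss) = All.++⁺ (arities-pos M s) (aritiess-pos M ss)

mutual
  arities-big : ∀ M {t} → Schroder t → Occurs M t → Any (2 ≤_) (arities M t)
  arities-big M (node 2≤ _) here with M ≟ M
  ... | yes _  = here 2≤
  ... | no  ne = ⊥-elim (ne refl)
  arities-big M {node ℓ _} (node 2≤ ss) (there o) with ℓ ≟ M
  ... | yes _ = here 2≤
  ... | no  _ = aritiess-big M ss o

  aritiess-big : ∀ M {ts} → All Schroder ts → Any (Occurs M) ts → Any (2 ≤_) (aritiess M ts)
  aritiess-big M (s ∷ _)  (here o)          = Any.++⁺ˡ (arities-big M s o)
  aritiess-big M {t ∷ _} (_ ∷ ss) (there o) = Any.++⁺ʳ (arities M t) (aritiess-big M ss o)

nth-tabulate : ∀ {k} (f : Fin k → ℕ) (i : Fin k) → nth (tabulate f) (toℕ i) ≡ f i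
nth-tabulate f Fin.zero    = refl
nth-tabulate f (Fin.suc i) = nth-tabulate (λ j → f (Fin.suc j)) i

nth-ext : ∀ {k} xs ys → length xs ≡ k → length ys ≡ k →
          (∀ (j : Fin k) → nth xs (toℕ j) ≡ nth ys (toℕ j)) → xs ≡ ys
nth-ext {zero}  []       []       _  _  _ = refl
nth-ext {suc k} (x ∷ xs) (y ∷ ys) lx ly e =
  cong₂ _∷_ (e Fin.zero) (nth-ext xs ys (suc-injective lx) (suc-injective ly) (λ j → e (Fin.suc j)))

-- Parts of a composition are positive (nth defaults to 1 out of range).
nth-pos : ∀ {xs} → All (1 ≤_) xs → ∀ i → 1 ≤ nth xs i
nth-pos []       i       = s≤s z≤n
nth-pos (p ∷ _)  zero    = p
nth-pos (_ ∷ ps) (suc i) = nth-pos ps i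

-- List sums against the finite sums ∑ of the library, for which sums are permutation-invariant.
sum-tabulate : ∀ {k} (f : Fin k → ℕ) → sum (tabulate f) ≡ ∑ f
sum-tabulate {zero}  f = refl
sum-tabulate {suc k} f = cong (f Fin.zero +_) (sum-tabulate (λ j → f (Fin.suc j)))

sum-nth : ∀ {k} xs → length xs ≡ k → ∑ {k} (λ i → nth xs (toℕ i)) ≡ sum xs
sum-nth {zero}  []       _ = refl
sum-nth {suc k} (x ∷ xs) l = cong (x +_) (sum-nth xs (suc-injective l))

reorder : ∀ {k} → Permutation′ k → List ℕ → List ℕ
reorder {k} π cs = tabulate (λ (j : Fin k) → nth cs (toℕ (π ⟨$⟩ˡ j)))

reorder-comp : ∀ {n k cs} (π : Permutation′ k) → IsComp n k cs → IsComp n k (reorder π cs)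
reorder-comp {n} {k} {cs} π (l , ps , s) =
  length-tabulate _ ,
  All.tabulate⁺ (λ j → nth-pos ps _) ,
  (begin
    sum (reorder π cs)                 ≡⟨ sum-tabulate (λ j → part (π ⟨$⟩ˡ j)) ⟩
    ∑ (λ j → part (π ⟨$⟩ˡ j))          ≡⟨ ∑-permute part (flip π) ⟨
    ∑ part                             ≡⟨ sum-nth cs l ⟩
    sum cs                             ≡⟨ s ⟩
    n                                  ∎)
  where
  open ≡-Reasoning
  part : Fin k → ℕ
  part i = nth cs (toℕ i)

reorder-cancel : ∀ {k cs} (π : Permutation′ k) → length cs ≡ k → reorder (flip π) (reorder π cs) ≡ cs
reorder-cancel {k} {cs} π l = nth-ext _ cs (length-tabulate _) l (λ j → begin
  nth (reorder (flip π) (reorder π cs)) (toℕ j)  ≡⟨ nth-tabulate _ j ⟩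
  nth (reorder π cs) (toℕ (π ⟨$⟩ʳ j))            ≡⟨ nth-tabulate _ (π ⟨$⟩ʳ j) ⟩
  nth cs (toℕ (π ⟨$⟩ˡ (π ⟨$⟩ʳ j)))              ≡⟨ cong (λ i → nth cs (toℕ i)) (inverseˡ π) ⟩
  nth cs (toℕ j)                                 ∎)
  where open ≡-Reasoning

reorder-bij : ∀ {n k} (π : Permutation′ k) → BijectionOn (IsComp n k) (IsComp n k) (reorder π)
reorder-bij π = record
  { maps      = reorder-comp π
  ; injective = λ {cs} {cs′} c c′ e →
      trans (sym (reorder-cancel π (proj₁ c))) (trans (cong (reorder (flip π)) e) (reorder-cancel π (proj₁ c′)))
  ; onto      = λ {xs} c → reorder (flip π) xs , reorder-comp (flip π) c , reorder-cancel (flip π) (proj₁ c)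
  }

-- graft uses, internally, the arity function sending left-to-right
-- position p to the part assigned to it by the leaf order.
graft-arity : (rule : LeafOrder) (T : Tree) (cs : List ℕ) →
              Σ (ℕ → ℕ) (λ a → graft rule T cs ≡ Graft.grafted a (suc (maxLabel T)) T 0)
graft-arity rule T cs = _ , refl

arity : LeafOrder → Tree → List ℕ → ℕ → ℕ
arity rule T cs = proj₁ (graft-arity rule T cs)

arity-inside : ∀ rule T cs {p} (p<k : p < leafCount T) → arity rule T cs p ≡ nth cs (toℕ (rule T ⟨$⟩ˡ fromℕ< p<k))
arity-inside rule T cs {p} p<k with p <? leafCount T
... | yes _   = refl
... | no  p≮k = contradiction p<k p≮k

arity-pos : ∀ rule T {cs} → All (1 ≤_) cs → ∀ p → 1 ≤ arity rule T cs p
arity-pos rule T ps p with p <? leafCount T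
... | yes _ = nth-pos ps _
... | no  _ = ≤-refl

window-tabulate : ∀ a p k → window a p k ≡ tabulate (λ (j : Fin k) → a (p + toℕ j))
window-tabulate a p zero    = refl
window-tabulate a p (suc k) =
  cong₂ _∷_ (cong a (sym (+-identityʳ p)))
            (trans (window-tabulate a (suc p) k) (tabulate-cong (λ j → cong a (sym (+-suc p (toℕ j))))))

arity-window : ∀ rule T cs → window (arity rule T cs) 0 (leafCount T) ≡ reorder (rule T) cs
arity-window rule T cs =
  trans (window-tabulate (arity rule T cs) 0 (leafCount T))
        (tabulate-cong (λ j → trans (arity-inside rule T cs (toℕ<n j))
                                    (cong (λ i → nth cs (toℕ (rule T ⟨$⟩ˡ i))) (fromℕ<-toℕ j (toℕ<n j)))))

GraftInput : ℕ → ℕ × (Tree × List ℕ) → Set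
GraftInput n (k , T , cs) = (1 ≤ k × k < n) × (WISTree k T × IsComp n k cs)

module _ (rule : LeafOrder) {n k T cs} (wT : WISTree k T) (c : IsComp n k cs) where

  private
    a = arity rule T cs
    M = maxLabel T

    labelled : Labelled M T
    labelled = let (_ , _ , L , lab) = wT in subst (λ L → Labelled L T) (sym (labelled-max lab)) lab

    c′ : IsComp n (leafCount T) cs
    c′ = subst (λ k → IsComp n k cs) (sym (proj₁ (proj₂ wT))) c

    window-comp : IsComp n (leafCount T) (window a 0 (leafCount T))
    window-comp = subst (IsComp n (leafCount T)) (sym (arity-window rule T cs)) (reorder-comp (rule T) c′)

    a-pos : ∀ p → 1 ≤ a p
    a-pos = arity-pos rule T (proj₁ (proj₂ c))

  graft-wis : k < n → Schroder (graft rule T cs) × leafCount (graft rule T cs) ≡ n ×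
                      Labelled (suc M) (graft rule T cs)
  graft-wis k<n =
    Graft.graftAt-schroder a (suc M) 0 (proj₁ wT) ,
    trans (Graft.graftAt-leafCount a (suc M) a-pos T 0) (proj₂ (proj₂ window-comp)) ,
    graftAt-labels a M 0 (s≤s z≤n) (proj₁ labelled) ,
    occurs
    where
    big = some-part≥2 window-comp (subst (_< n) (sym (proj₁ (proj₂ wT))) k<n)
    occurs : ∀ v → 1 ≤ v → v ≤ suc M → Occurs v (graft rule T cs)
    occurs v 1≤v v≤M+1 with m≤n⇒m<n∨m≡n v≤M+1
    ... | inj₁ v≤M  = Graft.graftAt-occurs a (suc M) 0 (proj₂ labelled v 1≤v (≤-pred v≤M))
    ... | inj₂ refl = Graft.graftAt-occurs-new a (suc M) T 0 big

  prune-graft : prune (suc M) (graft rule T cs) ≡ T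
  prune-graft = prune-graftAt a M 0 (proj₁ labelled)

  arities-graft : arities (suc M) (graft rule T cs) ≡ reorder (rule T) cs
  arities-graft = trans (arities-graftAt a M a-pos 0 (proj₁ labelled)) (arity-window rule T cs)

-- The tree can be read off the graft: it is the graft pruned at its top label.
graft-tree-injective : ∀ rule {n k k′ T T′ cs cs′} → WISTree k T → WISTree k′ T′ →
  IsComp n k cs → IsComp n k′ cs′ → k < n → k′ < n → graft rule T cs ≡ graft rule T′ cs′ → T ≡ T′
graft-tree-injective rule {T = T} {T′} {cs} {cs′} wT wT′ c c′ k<n k′<n e = begin
  T                                             ≡⟨ prune-graft rule wT c ⟨
  prune (suc (maxLabel T)) (graft rule T cs)    ≡⟨ cong₂ prune top≡ e ⟩
  prune (suc (maxLabel T′)) (graft rule T′ cs′) ≡⟨ prune-graft rule wT′ c′ ⟩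
  T′                                            ∎
  where
  open ≡-Reasoning
  top≡ : suc (maxLabel T) ≡ suc (maxLabel T′)
  top≡ = trans (sym (labelled-max (proj₂ (proj₂ (graft-wis rule wT c k<n)))))
               (trans (cong maxLabel e) (labelled-max (proj₂ (proj₂ (graft-wis rule wT′ c′ k′<n)))))

-- The composition is then read off the arities of the nodes with the top label.
graft-injective : ∀ rule {n k k′ T T′ cs cs′} → WISTree k T → WISTree k′ T′ →
  IsComp n k cs → IsComp n k′ cs′ → k < n → k′ < n →
  graft rule T cs ≡ graft rule T′ cs′ → k ≡ k′ × T ≡ T′ × cs ≡ cs′
graft-injective rule {T = T} {cs = cs} {cs′} wT wT′ c c′ k<n k′<n e
  with graft-tree-injective rule wT wT′ c c′ k<n k′<n e
... | refl with trans (sym (proj₁ (proj₂ wT))) (proj₁ (proj₂ wT′))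
... | refl = refl , refl ,
  injective (reorder-bij (rule T)) (subst (λ k → IsComp _ k cs) lc c) (subst (λ k → IsComp _ k cs′) lc c′)
    (trans (sym (arities-graft rule wT c)) (trans (cong (arities (suc (maxLabel T))) e) (arities-graft rule wT c′)))
  where
  lc = sym (proj₁ (proj₂ wT))

-- Every tree with n ≥ 2 leaves is a graft: prune its top label, and take the
-- composition whose reordering gives the recorded arities.
graft-onto : ∀ rule {n t} → 2 ≤ n → WISTree n t →
  Σ (ℕ × (Tree × List ℕ)) (λ (k , T , cs) → GraftInput n (k , T , cs) × graft rule T cs ≡ t)
graft-onto rule 2≤n (leaf , refl , _) = contradiction 2≤n (λ { (s≤s ()) })
graft-onto rule _ (_ , _ , zero , node 0<ℓ ℓ≤0 _ , _) = contradiction ℓ≤0 (<⇒≱ 0<ℓ)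
graft-onto rule {n} {t} _ (s , lc , suc K , l , occ) =
  (leafCount T , T , cs) , ((schroder-leaves (proj₁ wT) , k<n) , wT , c) , regraft
  where
  T = prune (suc K) t
  labT : Labelled K T
  labT = prune-labels K l , λ v 1≤v v≤K → prune-occurs K v≤K l (occ v 1≤v (m≤n⇒m≤1+n v≤K))
  wT : WISTree (leafCount T) T
  wT = prune-schroder (suc K) s , refl , K , labT
  ar : IsComp n (leafCount T) (arities (suc K) t)
  ar = arities-length (suc K) t , arities-pos (suc K) s , trans (arities-sum K l) lc
  k<n : leafCount T < n
  k<n = parts<sum ar (arities-big (suc K) s (occ (suc K) (s≤s z≤n) ≤-refl))
  cs = proj₁ (onto (reorder-bij (rule T)) ar)
  c  = proj₁ (proj₂ (onto (reorder-bij (rule T)) ar))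
  regraft : graft rule T cs ≡ t
  regraft = trans (cong (λ M → Graft.grafted (arity rule T cs) (suc M) T 0) (labelled-max labT))
                  (graftAt-prune (arity rule T cs) K 0 l s
                    (trans (arity-window rule T cs) (proj₂ (proj₂ (onto (reorder-bij (rule T)) ar)))))

graft-bij : ∀ rule n → 2 ≤ n → BijectionOn (GraftInput n) (WISTree n) (λ (k , T , cs) → graft rule T cs)
graft-bij rule n 2≤n = record
  { maps      = λ ((_ , k<n) , wT , c) → let (s , l , lab) = graft-wis rule wT c k<n in s , l , _ , lab
  ; injective = λ ((_ , k<n) , wT , c) ((_ , k′<n) , wT′ , c′) e →
      let (k≡ , T≡ , cs≡) = graft-injective rule wT wT′ c c′ k<n k′<n e in cong₂ _,_ k≡ (cong₂ _,_ T≡ cs≡)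
  ; onto      = graft-onto rule 2≤n
  }

scan-range : ∀ n K acc s → 1 ≤ K → 1 ≤ proj₁ (scan n K acc s) × proj₁ (scan n K acc s) ≤ K
scan-range n (suc K) acc s _ with s <ᵇ acc + block n (suc K)
... | true  = s≤s z≤n , ≤-refl
... | false with K
...   | zero   = s≤s z≤n , ≤-refl
...   | suc K′ = Prod.map₂ m≤n⇒m≤1+n (scan-range n (suc K′) (acc + block n (suc (suc K′))) s (s≤s z≤n))

pick : ℕ → ℕ → ℕ × ℕ
pick m s = scan (suc (suc m)) (suc m) 0 s

pick-range : ∀ m s → 1 ≤ proj₁ (pick m s) × proj₁ (pick m s) ≤ suc m
pick-range m s = scan-range (suc (suc m)) (suc m) 0 s (s≤s z≤n)

unrankTreeF-fuel : ∀ rule {f f′} n s → 1 ≤ n → n ≤ f → n ≤ f′ → unrankTreeF rule f n s ≡ unrankTreeF rule f′ n s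
unrankTreeF-fuel rule {suc f} {suc f′} (suc zero)    s _ _ _ = refl
unrankTreeF-fuel rule {suc f} {suc f′} (suc (suc m)) s _ (s≤s n≤f) (s≤s n≤f′) =
  cong (λ T → graft rule T (unrankComposition (suc (suc m)) k (divN r (g k))))
       (unrankTreeF-fuel rule k (modN r (g k)) (proj₁ range) (≤-trans (proj₂ range) n≤f) (≤-trans (proj₂ range) n≤f′))
  where
  k = proj₁ (pick m s)
  r = proj₂ (pick m s)
  range = pick-range m s

unrankTree-step : ∀ rule m s → let k = proj₁ (pick m s); r = proj₂ (pick m s) in
  unrankTree rule (suc (suc m)) s ≡ graft rule (unrankTree rule k (modN r (g k))) (unrankComposition (suc (suc m)) k (divN r (g k)))
unrankTree-step rule m s =
  cong (λ T → graft rule T (unrankComposition (suc (suc m)) k (divN r (g k))))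
       (unrankTreeF-fuel rule k (modN r (g k)) (proj₁ (pick-range m s)) (proj₂ (pick-range m s)) ≤-refl)
  where
  k = proj₁ (pick m s)
  r = proj₂ (pick m s)

unique-leaf : ∀ {t} → WISTree 1 t → leaf ≡ t
unique-leaf {leaf}      _                     = refl
unique-leaf {node _ ts} (node 2≤ ss , lc , _) = contradiction (≤-trans 2≤ (schroders-leaves ss)) (<⇒≱ (s≤s (s≤s z≤n)) ∘ subst (2 ≤_) lc)

TreesRanked : LeafOrder → ℕ → Set
TreesRanked rule n = BijectionOn (Below (g n)) (WISTree n) (unrankTree rule n)

-- By strong induction on n: for n ≥ 2, UnrankTree(n, ·) is the composite of
-- the scan, division with remainder in each block, the enumerations of
-- smaller trees and of compositions, and grafting.
unrankTree-bij : ∀ rule n → 1 ≤ n → TreesRanked rule n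
unrankTree-bij rule = <-rec _ step
  where
  step : ∀ n → (∀ {k} → k < n → 1 ≤ k → TreesRanked rule k) → 1 ≤ n → TreesRanked rule n
  step (suc zero) _ _ = single-bij (leaf , refl , 0 , leaf , λ v 1≤v v≤0 → contradiction v≤0 (<⇒≱ 1≤v)) unique-leaf
  step n@(suc (suc m)) ih _ =
    bij-resize (sym (g-blocks m))
      (bij-cong (λ _ → sym (unrankTree-step rule m _))
        (∘-bij (scan-bij n (suc m))
          (∘-bij (Σ-bij (λ (1≤k , k<n) →
                           ∘-bij (divMod-bij _ _)
                                 (×-bij (ih k<n 1≤k) (unrankComposition-bij n _ 1≤k (<⇒≤ k<n)))))
                 (graft-bij rule n (s≤s (s≤s z≤n))))))

theorem9 : (rule : LeafOrder) (n : ℕ) → 1 ≤ n →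
    ((s : ℕ) → s < g n → WISTree n (unrankTree rule n s)) ×
    ((s s′ : ℕ) → s < g n → s′ < g n →
      unrankTree rule n s ≡ unrankTree rule n s′ → s ≡ s′) ×
    ((t : Tree) → WISTree n t → Σ ℕ (λ s → s < g n × unrankTree rule n s ≡ t))
theorem9 rule n 1≤n =
  (λ _ s<g → maps U s<g) ,
  (λ _ _ s<g s′<g → injective U s<g s′<g) ,
  (λ _ wt → onto U wt)
  where
  U = unrankTree-bij rule n 1≤n
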